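{- For any set of items $I$, any item $i\in I$, and any sequence of bins $\sigma$, if $p$ is a valid packing of $I$ into $\sigma$, then there is a valid packing of $I\setminus\{i\}$ into $\sigma$ that uses a subset of the bins used by $p$.
   Context: Items have positive integer sizes; $\sigma$ is a finite sequence of bins, each with a positive integer size. A partial packing assigns some items to bins so that the total size of items assigned to each bin is at most the bin's size; a packing assigns every item. A packing is valid if each empty bin (bin receiving no items) is smaller than every item packed in a bin occurring later in the sequence. A bin is used by a packing if at least one item is assigned to it. -}

module Defs where

open import Data.Nat using (ℕ; zero; suc; _+_; _≤_; _<_)
open import Data.Fin using (Fin)
open import Data.Maybe using (Maybe; just; nothing)
open import Data.Product using (Σ; _×_; ∃)
open import Relation.Binary.PropositionalEquality using (_≡_; _≢_)
open import Relation.Nullary using (¬_)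
import Data.Fin as F
open import Data.Unit using (⊤)

sumFin : {n : ℕ} → (Fin n → ℕ) → ℕ
sumFin {zero}  f = 0
sumFin {suc n} f = f F.zero + sumFin (λ k → f (F.suc k))

record Items (n : ℕ) : Set where
  field
    size     : Fin n → ℕ
    size-pos : ∀ j → 0 < size j

record Bins (m : ℕ) : Set where
  field
    bsize     : Fin m → ℕ
    bsize-pos : ∀ b → 0 < bsize b

Assignment : ℕ → ℕ → Set
Assignment n m = Fin n → Maybe (Fin m)

load : {n m : ℕ} → Items n → Assignment n m → Fin m → ℕ
load I p b = sumFin (λ j → contrib j (p j))
  where
    contrib : Fin _ → Maybe (Fin _) → ℕ
    contrib j nothing   = 0
    contrib j (just b') with b' F.≟ b
    ... | Relation.Nullary.yes _ = Items.size I j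
    ... | Relation.Nullary.no  _ = 0

IsPartialPacking : {n m : ℕ} → Items n → Bins m → Assignment n m → Set
IsPartialPacking I σ p = ∀ b → load I p b ≤ Bins.bsize σ b

Used : {n m : ℕ} → Assignment n m → Fin m → Set
Used p b = ∃ λ j → p j ≡ just b

IsPackingOf : {n m : ℕ} → Items n → (Fin n → Set) → Bins m → Assignment n m → Set
IsPackingOf I S σ p =
  IsPartialPacking I σ p ×
  (∀ j → S j → ∃ λ b → p j ≡ just b) ×
  (∀ j → ¬ S j → p j ≡ nothing)

Valid : {n m : ℕ} → Items n → Bins m → Assignment n m → Set
Valid I σ p = ∀ b → ¬ Used p b → ∀ j b' → p j ≡ just b' → b F.< b' →
  Bins.bsize σ b < Items.size I j

All : {n : ℕ} → Fin n → Set
All j = ⊤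

Without : {n : ℕ} → Fin n → Fin n → Set
Without i j = j ≢ i

-- Remove i from its bin h. The packing can then only be invalid at h, and only because of an item
-- j in a later bin b′ with size j ≤ bsize h; such a j fits into the now empty bin h, so move it
-- there, and b′ becomes the new candidate hole, strictly further right. Items only ever move left,
-- and every bin that is empty apart from the current hole was already empty in p, so validity
-- away from the hole is inherited from p. The cascade stops when the hole is filled or nothing to
-- its right fits into it.
module Submission where

open import Defs
open import Data.Nat using (ℕ; zero; suc; _+_; _≤_; _<_; z≤n)
open import Data.Nat.Properties
  using (≤-refl; ≤-reflexive; ≤-trans; <⇒≤; <-≤-trans; <-irrefl; ≰⇒>; _≤?_;
         +-identityʳ; +-suc; +-monoˡ-≤; +-mono-≤; m≤n+m; module ≤-Reasoning)
open import Data.Fin using (Fin; toℕ)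
import Data.Fin as F
open import Data.Fin.Properties using (any?; toℕ<n; suc-injective)
open import Data.Maybe using (Maybe; just; nothing)
import Data.Maybe.Properties as Maybe
open import Data.Vec.Functional using (Vector; updateAt)
open import Data.Vec.Functional.Properties using (updateAt-updates; updateAt-minimal)
open import Data.Product using (Σ; _×_; _,_; ∃)
open import Data.Sum using (_⊎_; inj₁; inj₂)
open import Data.Unit using (tt)
open import Function using (_∘_; const)
open import Relation.Binary.PropositionalEquality
open import Relation.Nullary using (¬_; Dec; yes; no; contradiction)
open import Relation.Nullary.Decidable using (_×-dec_)

private
  variable
    n m : ℕ

sumFin-mono : {f g : Fin n → ℕ} → (∀ j → f j ≤ g j) → sumFin f ≤ sumFin g
sumFin-mono {zero}  f≤g = z≤n
sumFin-mono {suc n} f≤g = +-mono-≤ (f≤g F.zero) (sumFin-mono (f≤g ∘ F.suc))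

sumFin-zero : {f : Fin n → ℕ} → (∀ j → f j ≡ 0) → sumFin f ≡ 0
sumFin-zero {zero}  f≗0 = refl
sumFin-zero {suc n} f≗0 = cong₂ _+_ (f≗0 F.zero) (sumFin-zero (f≗0 ∘ F.suc))

sumFin-single : {f : Fin n → ℕ} (j : Fin n) → (∀ k → k ≢ j → f k ≡ 0) → sumFin f ≡ f j
sumFin-single {suc n} {f} F.zero others≡0 =
  trans (cong (f F.zero +_) (sumFin-zero (λ k → others≡0 (F.suc k) λ ()))) (+-identityʳ _)
sumFin-single {suc n} (F.suc j) others≡0 =
  cong₂ _+_ (others≡0 F.zero λ ())
            (sumFin-single j λ k k≢j → others≡0 (F.suc k) (k≢j ∘ suc-injective))

updateAt-const⁻ : {A : Set} (xs : Vector A n) (j : Fin n) {x y : A} {k : Fin n} →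
  updateAt xs j (const x) k ≡ y → (k ≡ j × x ≡ y) ⊎ (k ≢ j × xs k ≡ y)
updateAt-const⁻ xs j {k = k} e with k F.≟ j
... | yes refl = inj₁ (refl , trans (sym (updateAt-updates k xs)) e)
... | no k≢j   = inj₂ (k≢j , trans (sym (updateAt-minimal k j xs k≢j)) e)

updateAt-nothing⁻ : (p : Assignment n m) (i : Fin n) {k : Fin n} {c : Fin m} →
  updateAt p i (const nothing) k ≡ just c → p k ≡ just c
updateAt-nothing⁻ p i e with updateAt-const⁻ p i e
... | inj₁ (_ , ())
... | inj₂ (_ , pk) = pk

_≟ₘ_ : (x y : Maybe (Fin m)) → Dec (x ≡ y)
_≟ₘ_ = Maybe.≡-dec F._≟_

-- The summand of `load` is local to its where-block and cannot be named; the meta `_` below is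
-- solved by the `refl` next to it, which gives it a name.
mutual
  loadSummand : Items n → Assignment n m → Fin m → Fin n → ℕ
  loadSummand = _

  load≡sumFin-loadSummand : (I : Items n) (q : Assignment n m) (b : Fin m) →
    load I q b ≡ sumFin (loadSummand I q b)
  load≡sumFin-loadSummand I q b = refl

module _ (I : Items n) (q : Assignment n m) {b : Fin m} {j : Fin n} where

  loadSummand-here : q j ≡ just b → loadSummand I q b j ≡ Items.size I j
  loadSummand-here qj rewrite qj with b F.≟ b
  ... | yes _   = refl
  ... | no b≢b = contradiction refl b≢b

  loadSummand-elsewhere : q j ≢ just b → loadSummand I q b j ≡ 0
  loadSummand-elsewhere qj≢b with q j
  ... | nothing = refl
  ... | just b′ with b′ F.≟ b
  ...   | yes refl = contradiction refl qj≢b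
  ...   | no _     = refl

module _ {I : Items n} {b : Fin m} where
  open ≤-Reasoning

  load-mono : {p q : Assignment n m} → (∀ {j} → q j ≡ just b → p j ≡ just b) →
    load I q b ≤ load I p b
  load-mono {p} {q} q⊆p = begin
    load I q b                  ≡⟨ load≡sumFin-loadSummand I q b ⟩
    sumFin (loadSummand I q b)  ≤⟨ sumFin-mono pointwise ⟩
    sumFin (loadSummand I p b)  ≡⟨ load≡sumFin-loadSummand I p b ⟨
    load I p b                  ∎
    where
    pointwise : ∀ j → loadSummand I q b j ≤ loadSummand I p b j
    pointwise j with q j ≟ₘ just b
    ... | yes qj  =
      ≤-reflexive (trans (loadSummand-here I q qj) (sym (loadSummand-here I p (q⊆p qj))))
    ... | no qj≢b = ≤-trans (≤-reflexive (loadSummand-elsewhere I q qj≢b)) z≤n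

  load-alone : {q : Assignment n m} {j : Fin n} → q j ≡ just b → (∀ k → k ≢ j → q k ≢ just b) →
    load I q b ≡ Items.size I j
  load-alone {q} {j} qj alone = begin-equality
    load I q b                  ≡⟨ load≡sumFin-loadSummand I q b ⟩
    sumFin (loadSummand I q b)  ≡⟨ sumFin-single j others≡0 ⟩
    loadSummand I q b j         ≡⟨ loadSummand-here I q qj ⟩
    Items.size I j              ∎
    where
    others≡0 : ∀ k → k ≢ j → loadSummand I q b k ≡ 0
    others≡0 k k≢j = loadSummand-elsewhere I q (alone k k≢j)

module _ (I : Items n) (σ : Bins m) where

  unassign-isPackingOf : {p : Assignment n m} (i : Fin n) → IsPackingOf I All σ p →
    IsPackingOf I (Without i) σ (updateAt p i (const nothing))
  unassign-isPackingOf {p} i (fits , assigned , _) = fits′ , assigned′ , unassigned′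
    where
    fits′ : IsPartialPacking I σ (updateAt p i (const nothing))
    fits′ c = ≤-trans (load-mono {p = p} (updateAt-nothing⁻ p i)) (fits c)
    assigned′ : ∀ k → k ≢ i → ∃ λ c → updateAt p i (const nothing) k ≡ just c
    assigned′ k k≢i with assigned k tt
    ... | c , pk = c , trans (updateAt-minimal k i p k≢i) pk
    unassigned′ : ∀ k → ¬ k ≢ i → updateAt p i (const nothing) k ≡ nothing
    unassigned′ k ¬k≢i with k F.≟ i
    ... | yes refl = updateAt-updates k p
    ... | no k≢i   = contradiction k≢i ¬k≢i

  move-isPackingOf : {S : Fin n → Set} {q : Assignment n m} {j : Fin n} {b h : Fin m} →
    IsPackingOf I S σ q → q j ≡ just b → ¬ Used q h → Items.size I j ≤ Bins.bsize σ h →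
    IsPackingOf I S σ (updateAt q j (const (just h)))
  move-isPackingOf {S} {q} {j} {b} {h} (fits , assigned , unassigned) qj h-empty j-fits =
    fits′ , assigned′ , unassigned′
    where
    q′ : Assignment n m
    q′ = updateAt q j (const (just h))
    fits′ : IsPartialPacking I σ q′
    fits′ c with c F.≟ h
    ... | yes refl = ≤-trans (≤-reflexive (load-alone (updateAt-updates j q) alone)) j-fits
      where
      alone : ∀ k → k ≢ j → q′ k ≢ just c
      alone k k≢j e = h-empty (k , trans (sym (updateAt-minimal k j q k≢j)) e)
    ... | no c≢h = ≤-trans (load-mono {p = q} stays) (fits c)
      where
      stays : ∀ {k} → q′ k ≡ just c → q k ≡ just c
      stays e with updateAt-const⁻ q j e
      ... | inj₁ (_ , refl) = contradiction refl c≢h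
      ... | inj₂ (_ , qk)   = qk
    assigned′ : ∀ k → S k → ∃ λ c → q′ k ≡ just c
    assigned′ k k∈S with k F.≟ j
    ... | yes refl = h , updateAt-updates k q
    ... | no k≢j with assigned k k∈S
    ...   | c , qk = c , trans (updateAt-minimal k j q k≢j) qk
    unassigned′ : ∀ k → ¬ S k → q′ k ≡ nothing
    unassigned′ k k∉S with k F.≟ j
    ... | yes refl = contradiction (trans (sym (unassigned k k∉S)) qj) λ ()
    ... | no k≢j   = trans (updateAt-minimal k j q k≢j) (unassigned k k∉S)

ValidAt : Items n → Bins m → Assignment n m → Fin m → Set
ValidAt I σ q b = ¬ Used q b → ∀ j b′ → q j ≡ just b′ → b F.< b′ → Bins.bsize σ b < Items.size I j

used? : (q : Assignment n m) (b : Fin m) → Dec (Used q b)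
used? q b = any? λ j → q j ≟ₘ just b

module Cascade (I : Items n) (σ : Bins m) (i : Fin n) {p : Assignment n m} (p-valid : Valid I σ p)
  where
  open Items I using (size)
  open Bins σ using (bsize)

  Repaired : Assignment n m → Set
  Repaired q = IsPackingOf I (Without i) σ q × Valid I σ q × (∀ b → Used q b → Used p b)

  record Invariant (q : Assignment n m) (hole : Fin m) : Set where
    field
      packing    : IsPackingOf I (Without i) σ q
      moves-left : ∀ {j c} → q j ≡ just c → ∃ λ c′ → p j ≡ just c′ × c F.≤ c′
      used⊆      : ∀ {b} → Used q b → Used p b
      empty⊆     : ∀ {b} → ¬ Used q b → b ≢ hole → ¬ Used p b
      hole-used  : Used p hole

  start : IsPackingOf I All σ p → {h : Fin m} → p i ≡ just h →
    Invariant (updateAt p i (const nothing)) h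
  start p-packing {h} pi = record
    { packing    = unassign-isPackingOf I σ i p-packing
    ; moves-left = λ e → _ , updateAt-nothing⁻ p i e , ≤-refl
    ; used⊆      = λ { (k , e) → k , updateAt-nothing⁻ p i e }
    ; empty⊆     = empty⊆
    ; hole-used  = i , pi
    }
    where
    q : Assignment n m
    q = updateAt p i (const nothing)
    empty⊆ : ∀ {b} → ¬ Used q b → b ≢ h → ¬ Used p b
    empty⊆ b-empty b≢h (k , pk) with k F.≟ i
    ... | yes refl = b≢h (Maybe.just-injective (trans (sym pk) pi))
    ... | no k≢i   = b-empty (k , trans (updateAt-minimal k i p k≢i) pk)

  move : ∀ {q h j b′} → Invariant q h → ¬ Used q h → q j ≡ just b′ → h F.< b′ → size j ≤ bsize h →
    Invariant (updateAt q j (const (just h))) b′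
  move {q} {h} {j} {b′} inv h-empty qj h<b′ j-fits = record
    { packing    = move-isPackingOf I σ packing qj h-empty j-fits
    ; moves-left = moves-left′
    ; used⊆      = used⊆′
    ; empty⊆     = empty⊆′
    ; hole-used  = used⊆ (j , qj)
    }
    where
    open Invariant inv
    q′ : Assignment n m
    q′ = updateAt q j (const (just h))
    moves-left′ : ∀ {k c} → q′ k ≡ just c → ∃ λ c′ → p k ≡ just c′ × c F.≤ c′
    moves-left′ e with updateAt-const⁻ q j e
    ... | inj₁ (refl , refl) with moves-left qj
    ...   | c′ , pj , b′≤c′ = c′ , pj , ≤-trans (<⇒≤ h<b′) b′≤c′
    moves-left′ e | inj₂ (_ , qk) = moves-left qk
    used⊆′ : ∀ {c} → Used q′ c → Used p c
    used⊆′ (k , e) with updateAt-const⁻ q j e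
    ... | inj₁ (_ , refl) = hole-used
    ... | inj₂ (_ , qk)   = used⊆ (k , qk)
    empty⊆′ : ∀ {c} → ¬ Used q′ c → c ≢ b′ → ¬ Used p c
    empty⊆′ {c} c-empty c≢b′ with c F.≟ h
    ... | yes refl = contradiction (j , updateAt-updates j q) c-empty
    ... | no c≢h   = empty⊆ c-empty-before c≢h
      where
      c-empty-before : ¬ Used q c
      c-empty-before (k , qk) with k F.≟ j
      ... | yes refl = c≢b′ (Maybe.just-injective (trans (sym qk) qj))
      ... | no k≢j   = c-empty (k , trans (updateAt-minimal k j q k≢j) qk)

  valid : ∀ {q h} → Invariant q h → ValidAt I σ q h → Valid I σ q
  valid {h = h} inv hole-valid b b-empty j c qj b<c with b F.≟ h
  ... | yes refl = hole-valid b-empty j c qj b<c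
  ... | no b≢h with Invariant.moves-left inv qj
  ...   | c′ , pj , c≤c′ = p-valid b (Invariant.empty⊆ inv b-empty b≢h) j c′ pj (<-≤-trans b<c c≤c′)

  done : ∀ {q h} → Invariant q h → ValidAt I σ q h → Repaired q
  done inv hole-valid = Invariant.packing inv , valid inv hole-valid , λ _ → Invariant.used⊆ inv

  Fitting : Assignment n m → Fin m → Set
  Fitting q h = ∃ λ j → ∃ λ c → q j ≡ just c × h F.< c × size j ≤ bsize h

  fitting? : (q : Assignment n m) (h : Fin m) → Dec (Fitting q h)
  fitting? q h = any? λ j → any? λ c → (q j ≟ₘ just c) ×-dec (h F.<? c) ×-dec (size j ≤? bsize h)

  -- The hole moves strictly right at every step, so the fuel d never runs out.
  cascade : (d : ℕ) (q : Assignment n m) (h : Fin m) → m ≤ toℕ h + d → Invariant q h → ∃ Repaired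
  cascade zero q h m≤h+0 _ =
    contradiction (<-≤-trans (toℕ<n h) m≤h+0) (<-irrefl (sym (+-identityʳ (toℕ h))))
  cascade (suc d) q h m≤h+d+1 inv with used? q h
  ... | yes h-used = q , done inv λ h-empty → contradiction h-used h-empty
  ... | no h-empty with fitting? q h
  ...   | no nothing-fits =
    q , done inv λ _ j c qj h<c → ≰⇒> λ fits → nothing-fits (j , c , qj , h<c , fits)
  ...   | yes (j , c , qj , h<c , fits) =
    cascade d (updateAt q j (const (just h))) c m≤c+d (move inv h-empty qj h<c fits)
    where
    m≤c+d : m ≤ toℕ c + d
    m≤c+d = ≤-trans m≤h+d+1 (≤-trans (≤-reflexive (+-suc (toℕ h) d)) (+-monoˡ-≤ d h<c))

lemma1 : {n m : ℕ} (I : Items n) (i : Fin n) (σ : Bins m) (p : Assignment n m) →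
    IsPackingOf I All σ p → Valid I σ p →
    Σ (Assignment n m) λ q →
      IsPackingOf I (Without i) σ q × Valid I σ q × (∀ b → Used q b → Used p b)
lemma1 {m = m} I i σ p p-packing@(_ , assigned , _) p-valid with assigned i tt
... | h , pi = cascade m (updateAt p i (const nothing)) h (m≤n+m m (toℕ h)) (start p-packing pi)
  where open Cascade I σ i p-valid
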